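{- Let $n \ge 3$ and let $G = P_2 \square P_n$. If there exists a minimum dominating set of $G$ containing no vertex of degree two, then $n = 3$ or $n = 6$.
   Context: $P_2 \square P_n$ is the Cartesian product of the path on 2 vertices with the path on $n$ vertices (vertex set $\{x_1,\dots,x_n,y_1,\dots,y_n\}$, edges $x_ix_{i+1}$, $y_iy_{i+1}$, $x_iy_i$); for $n\ge 3$ its vertices of degree two are $x_1,y_1,x_n,y_n$. A dominating set is a set $D$ of vertices such that every vertex not in $D$ is adjacent to a vertex of $D$; a minimum dominating set is one of minimum cardinality. -}

module Defs where

open import Data.Bool using (Bool; true; false; T; if_then_else_)
open import Data.Nat using (ℕ; zero; suc; _+_; _≤_; _≡ᵇ_)
open import Data.Fin using (Fin; toℕ)
open import Data.Product using (_×_; Σ; _,_)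
open import Data.Sum using (_⊎_)
open import Data.List using (List; length; filter; allFin; cartesianProduct)
open import Relation.Nullary using (¬_)
open import Relation.Nullary.Decidable using (⌊_⌋; does)
open import Relation.Binary.PropositionalEquality using (_≡_)

-- Vertices of P₂ □ Pₙ: (false , i) is x_{i+1}, (true , i) is y_{i+1}.
Vertex : ℕ → Set
Vertex n = Bool × Fin n

boolEq : Bool → Bool → Bool
boolEq true  true  = true
boolEq false false = true
boolEq _     _     = false

adjᵇ : ∀ {n} → Vertex n → Vertex n → Bool
adjᵇ (a , i) (b , j) =
  if boolEq a b
  then (suc (toℕ i) ≡ᵇ toℕ j) Data.Bool.∨ (suc (toℕ j) ≡ᵇ toℕ i)
  else (toℕ i ≡ᵇ toℕ j)

Adj : ∀ {n} → Vertex n → Vertex n → Set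
Adj u v = T (adjᵇ u v)

vertices : (n : ℕ) → List (Vertex n)
vertices n = cartesianProduct (true Data.List.∷ false Data.List.∷ Data.List.[]) (allFin n)

degree : ∀ {n} → Vertex n → ℕ
degree {n} v = length (Data.List.filter (λ u → T? (adjᵇ v u)) (vertices n))
  where
  open import Data.Bool.Properties using (T?)

VSet : ℕ → Set
VSet n = Vertex n → Bool

_∈ₛ_ : ∀ {n} → Vertex n → VSet n → Set
v ∈ₛ D = T (D v)

card : ∀ {n} → VSet n → ℕ
card {n} D = length (Data.List.filter (λ v → T? (D v)) (vertices n))
  where
  open import Data.Bool.Properties using (T?)

IsDominating : ∀ {n} → VSet n → Set
IsDominating {n} D =
  ∀ (v : Vertex n) → ¬ (v ∈ₛ D) → Σ (Vertex n) (λ u → (u ∈ₛ D) × Adj u v)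

IsMinimumDominating : ∀ {n} → VSet n → Set
IsMinimumDominating {n} D =
  IsDominating D × (∀ (D' : VSet n) → IsDominating D' → card D ≤ card D')

module Submission where

-- Read a vertex set D of G = P₂ □ Pₙ column by column: column
-- i is the pair (x_i ∈ D , y_i ∈ D).  D is dominating exactly when every
-- column is "covered" by itself and its two neighbouring columns, a
-- condition on three consecutive columns.  Padding the column sequence
-- with empty columns at both ends, a corner-free dominating set is a
-- locally covered sequence whose first and last real columns are empty.
--
-- For such sequences a potential `bound p c r` (a dynamic-programming
-- table, periodic in r from r = 7 on) satisfies a Bellman inequality on
-- every covered triple of columns, verified by evaluation over all
-- 8 · 4³ cases.  Summing it along the sequence gives
--     bound ∅ ∅ (stage n) + n ≤ 2 |D| + 1,
-- and the table shows bound ∅ ∅ (stage n) ≥ 4 unless n ∈ {3, 6}.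
-- On the other hand an explicit zig-zag dominating set has 2|E| ≤ n + 2
-- (so γ(P₂ □ Pₙ) ≤ ⌊(n+2)/2⌋).  For a minimum D the two bounds force
-- bound ∅ ∅ (stage n) ≤ 3, hence n = 3 or n = 6.

open import Defs
open import Data.Nat using (ℕ; _≤_)
open import Data.Product using (Σ; _×_)
open import Data.Sum using (_⊎_)
open import Relation.Nullary using (¬_)
open import Relation.Binary.PropositionalEquality using (_≡_)

open import Data.Bool using (Bool; true; false; T; not; _∧_; _∨_; if_then_else_)
open import Data.Bool.Properties using (T?; T-∧; T-∨; T-≡; T-not-≡; ¬-not)
open import Data.Empty using (⊥-elim)
open import Data.Fin using (Fin; zero; suc; toℕ; fromℕ; fromℕ<; inject₁)
open import Data.Fin.Properties using (toℕ-fromℕ; toℕ-fromℕ<; toℕ-inject₁; toℕ<n; toℕ-injective)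
open import Data.List using (List; []; _++_; length; filter; map; tabulate)
open import Data.List.Properties using (length-++; filter-++)
open import Data.Nat using (zero; suc; _+_; _*_; _<_; z≤n; s≤s; z<s; s<s; _≤ᵇ_; _<ᵇ_; _≡ᵇ_; _<?_)
open import Data.Nat.Properties
open import Algebra.Properties.CommutativeMonoid.Sum +-0-commutativeMonoid
  using (sum-syntax; sum-cong-≗; sum-replicate-zero; ∑-distrib-+)
open import Data.Nat.Tactic.RingSolver using (solve-∀)
open import Data.Product using (_,_; proj₁; proj₂)
open import Data.Sum using (inj₁; inj₂)
import Data.Sum as Sum
open import Data.Unit using (tt)
open import Function using (_∘_; Equivalence)
open import Relation.Nullary using (yes; no)
open import Relation.Binary.PropositionalEquality
  using (refl; sym; trans; cong; cong₂; subst; subst₂; module ≡-Reasoning)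

open Equivalence using (to; from)

-- Columns and local covering

-- A column of P₂ □ Pₙ: (is x_i chosen , is y_i chosen).
Col : Set
Col = Bool × Bool

∅ : Col
∅ = (false , false)

inRow : Bool → Col → Bool
inRow false c = proj₁ c
inRow true  c = proj₂ c

nonempty : Col → Bool
nonempty c = proj₁ c ∨ proj₂ c

bit : Bool → ℕ
bit true  = 1
bit false = 0

weight : Col → ℕ
weight c = bit (proj₁ c) + bit (proj₂ c)

-- The row-a vertex of column c is dominated, given the previous column p
-- and the next column d: by c itself (directly or across the rung), or by
-- the row-a vertex of p or of d.
rowCovered : Bool → Col → Col → Col → Bool
rowCovered a p c d = nonempty c ∨ (inRow a p ∨ inRow a d)

covered : Col → Col → Col → Bool
covered p c d = rowCovered false p c d ∧ rowCovered true p c d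

-- A column sequence h lists the columns 1, 2, … at h 1, h 2, …; h 0 is a
-- virtual column before the first one.
LocallyCovering : ℕ → (ℕ → Col) → Set
LocallyCovering n h = ∀ k → k < n → T (covered (h k) (h (suc k)) (h (suc (suc k))))

covered-row : ∀ a p c d → T (covered p c d) → T (rowCovered a p c d)
covered-row false p c d cov = proj₁ (to T-∧ cov)
covered-row true  p c d cov = proj₂ (to T-∧ cov)

inRow⇒nonempty : ∀ a c → T (inRow a c) → T (nonempty c)
inRow⇒nonempty false (true , y) _ = tt
inRow⇒nonempty true  (x , true) _ = from T-∨ (inj₂ tt)

nonempty⇒otherRow : ∀ a c → T (nonempty c) → ¬ T (inRow a c) → T (inRow (not a) c)
nonempty⇒otherRow false (false , true) _ _ = tt
nonempty⇒otherRow false (true , y) _ notIn = ⊥-elim (notIn tt)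
nonempty⇒otherRow true (true , y) _ _ = tt
nonempty⇒otherRow true (false , true) _ notIn = ⊥-elim (notIn tt)

shift : ∀ {A : Set} → (ℕ → A) → ℕ → A
shift h k = h (suc k)

weightOf : (ℕ → Col) → ℕ → ℕ
weightOf h zero    = 0
weightOf h (suc m) = weight (h 1) + weightOf (shift h) m

weightOf-snoc : ∀ m h → weightOf h (suc m) ≡ weightOf h m + weight (h (suc m))
weightOf-snoc zero    h = +-comm (weight (h 1)) 0
weightOf-snoc (suc m) h =
  trans (cong (weight (h 1) +_) (weightOf-snoc m (shift h)))
        (sym (+-assoc (weight (h 1)) _ _))

weightOf-cong : ∀ m g h → (∀ k → k < m → g (suc k) ≡ h (suc k)) → weightOf g m ≡ weightOf h m
weightOf-cong zero    g h eq = refl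
weightOf-cong (suc m) g h eq =
  cong₂ _+_ (cong weight (eq 0 z<s))
            (weightOf-cong m (shift g) (shift h) (λ k k<m → eq (suc k) (s<s k<m)))

weightOf-sparse : ∀ m h → (∀ k → weight (h (suc k)) + weight (h (suc (suc k))) ≤ 1) →
                  2 * weightOf h m ≤ suc m
weightOf-sparse zero          h sparse = z≤n
weightOf-sparse (suc zero)    h sparse =
  *-monoʳ-≤ 2 (≤-trans (≤-reflexive (+-identityʳ (weight (h 1))))
                      (≤-trans (m≤m+n (weight (h 1)) _) (sparse 0)))
weightOf-sparse (suc (suc m)) h sparse = begin
  2 * (w₁ + (w₂ + rest))   ≡⟨ cong (2 *_) (sym (+-assoc w₁ w₂ rest)) ⟩
  2 * ((w₁ + w₂) + rest)   ≡⟨ *-distribˡ-+ 2 (w₁ + w₂) rest ⟩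
  2 * (w₁ + w₂) + 2 * rest ≤⟨ +-mono-≤ (*-monoʳ-≤ 2 (sparse 0)) ih ⟩
  2 + suc m                ∎
  where
  open ≤-Reasoning
  w₁ = weight (h 1)
  w₂ = weight (h 2)
  rest = weightOf (shift (shift h)) m
  ih : 2 * rest ≤ suc m
  ih = weightOf-sparse m (shift (shift h)) (λ k → sparse (suc (suc k)))

-- Number of list elements satisfying a boolean predicate; `card` and
-- `degree` from Defs are both of this form over `vertices n`.
count : ∀ {A : Set} → (A → Bool) → List A → ℕ
count f xs = length (filter (λ u → T? (f u)) xs)

count-++ : ∀ {A : Set} (f : A → Bool) xs ys → count f (xs ++ ys) ≡ count f xs + count f ys
count-++ f xs ys =
  trans (cong length (filter-++ (λ u → T? (f u)) xs ys)) (length-++ (filter (λ u → T? (f u)) xs))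

count-row : ∀ {n} m (f : Vertex n → Bool) a (g : Fin m → Fin n) →
            count f (map (a ,_) (tabulate g)) ≡ ∑[ i < m ] bit (f (a , g i))
count-row zero    f a g = refl
count-row (suc m) f a g with f (a , g zero)
... | true  = cong suc (count-row m f a (λ i → g (suc i)))
... | false = count-row m f a (λ i → g (suc i))

rowCount : ∀ {n} → (Vertex n → Bool) → Bool → ℕ
rowCount {n} f a = ∑[ i < n ] bit (f (a , i))

-- `vertices n` lists the y-row and then the x-row.
count-vertices : ∀ n (f : Vertex n → Bool) →
                 count f (vertices n) ≡ rowCount f true + rowCount f false
count-vertices n f = begin
  count f (row true ++ (row false ++ []))
    ≡⟨ count-++ f (row true) _ ⟩
  count f (row true) + count f (row false ++ [])
    ≡⟨ cong (count f (row true) +_) (trans (count-++ f (row false) []) (+-identityʳ _)) ⟩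
  count f (row true) + count f (row false)
    ≡⟨ cong₂ _+_ (count-row n f true (λ i → i)) (count-row n f false (λ i → i)) ⟩
  rowCount f true + rowCount f false ∎
  where
  open ≡-Reasoning
  row : Bool → List (Vertex n)
  row a = map (a ,_) (tabulate (λ i → i))

setOf : ∀ n → (ℕ → Col) → VSet n
setOf n h (a , i) = inRow a (h (suc (toℕ i)))

sum-columns : ∀ n (h : ℕ → Col) → ∑[ i < n ] weight (h (suc (toℕ i))) ≡ weightOf h n
sum-columns zero    h = refl
sum-columns (suc n) h = cong (weight (h 1) +_) (sum-columns n (shift h))

card-columns : ∀ n (h : ℕ → Col) (D : VSet n) → (∀ v → D v ≡ setOf n h v) → card D ≡ weightOf h n
card-columns n h D eq = begin
  card D                                    ≡⟨ count-vertices n D ⟩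
  rowCount D true + rowCount D false        ≡⟨ +-comm (rowCount D true) _ ⟩
  rowCount D false + rowCount D true        ≡⟨ sym (∑-distrib-+ (row false) (row true)) ⟩
  ∑[ i < n ] (row false i + row true i)     ≡⟨ sum-cong-≗ {n} byColumn ⟩
  ∑[ i < n ] weight (h (suc (toℕ i)))       ≡⟨ sum-columns n h ⟩
  weightOf h n                              ∎
  where
  open ≡-Reasoning
  row : Bool → Fin n → ℕ
  row a i = bit (D (a , i))
  byColumn : ∀ i → row false i + row true i ≡ weight (h (suc (toℕ i)))
  byColumn i = cong₂ (λ x y → bit x + bit y) (eq (false , i)) (eq (true , i))

consecutive : ∀ {n} → Fin n → Fin n → Bool
consecutive j i = (suc (toℕ j) ≡ᵇ toℕ i) ∨ (suc (toℕ i) ≡ᵇ toℕ j)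

adj-row : ∀ {n} a (j i : Fin n) → adjᵇ (a , j) (a , i) ≡ consecutive j i
adj-row false j i = refl
adj-row true  j i = refl

rung-adjacent : ∀ {n} a (i : Fin n) → Adj (not a , i) (a , i)
rung-adjacent false i = ≡⇒≡ᵇ (toℕ i) (toℕ i) refl
rung-adjacent true  i = ≡⇒≡ᵇ (toℕ i) (toℕ i) refl

row-adjacent : ∀ {n} a (j i : Fin n) → suc (toℕ j) ≡ toℕ i ⊎ suc (toℕ i) ≡ toℕ j →
               Adj (a , j) (a , i)
row-adjacent a j i e = subst T (sym (adj-row a j i)) (from T-∨ (Sum.map (≡⇒≡ᵇ _ _) (≡⇒≡ᵇ _ _) e))

row-neighbour : ∀ {n} a (j i : Fin n) → Adj (a , j) (a , i) →
                suc (toℕ j) ≡ toℕ i ⊎ suc (toℕ i) ≡ toℕ j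
row-neighbour a j i adj with to T-∨ (subst T (adj-row a j i) adj)
... | inj₁ j+1≡i = inj₁ (≡ᵇ⇒≡ _ _ j+1≡i)
... | inj₂ i+1≡j = inj₂ (≡ᵇ⇒≡ _ _ i+1≡j)

neighbour-cases : ∀ {n} a b (j i : Fin n) → Adj (b , j) (a , i) →
  (b ≡ not a × j ≡ i) ⊎ (b ≡ a × (suc (toℕ j) ≡ toℕ i ⊎ suc (toℕ i) ≡ toℕ j))
neighbour-cases false true  j i adj = inj₁ (refl , toℕ-injective (≡ᵇ⇒≡ _ _ adj))
neighbour-cases true  false j i adj = inj₁ (refl , toℕ-injective (≡ᵇ⇒≡ _ _ adj))
neighbour-cases false false j i adj = inj₂ (refl , row-neighbour false j i adj)
neighbour-cases true  true  j i adj = inj₂ (refl , row-neighbour true j i adj)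

rung-sum : ∀ {n} (j : Fin n) → ∑[ i < n ] bit (toℕ j ≡ᵇ toℕ i) ≡ 1
rung-sum {suc n} zero    = cong suc (sum-replicate-zero n)
rung-sum {suc n} (suc j) = rung-sum j

path-first : ∀ k → ∑[ i < suc (suc k) ] bit (consecutive zero i) ≡ 1
path-first k = cong suc (sum-replicate-zero k)

path-last : ∀ k → ∑[ i < suc (suc k) ] bit (consecutive (fromℕ (suc k)) i) ≡ 1
path-last zero    = refl
path-last (suc k) = path-last k

degree-split : ∀ {n} a (j : Fin n) → degree (a , j) ≡ ∑[ i < n ] bit (consecutive j i) + 1
degree-split {n} false j = begin
  degree (false , j)                ≡⟨ count-vertices n (adjᵇ (false , j)) ⟩
  rowCount (adjᵇ (false , j)) true + inPath  ≡⟨ cong (_+ inPath) (rung-sum j) ⟩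
  1 + inPath                        ≡⟨ +-comm 1 inPath ⟩
  inPath + 1                        ∎
  where
  open ≡-Reasoning
  inPath = ∑[ i < n ] bit (consecutive j i)
degree-split {n} true j =
  trans (count-vertices n (adjᵇ (true , j))) (cong (∑[ i < n ] bit (consecutive j i) +_) (rung-sum j))

corner-first : ∀ k a → degree {suc (suc k)} (a , zero) ≡ 2
corner-first k a = trans (degree-split a zero) (cong (_+ 1) (path-first k))

corner-last : ∀ k a → degree {suc (suc k)} (a , fromℕ (suc k)) ≡ 2
corner-last k a = trans (degree-split a (fromℕ (suc k))) (cong (_+ 1) (path-last k))

-- Domination is local covering of the columns

extend : ∀ {n} → (Fin n → Col) → ℕ → Col
extend {zero}  g k       = ∅
extend {suc n} g zero    = g zero
extend {suc n} g (suc k) = extend (λ i → g (suc i)) k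

extend-toℕ : ∀ {n} (g : Fin n → Col) i → extend g (toℕ i) ≡ g i
extend-toℕ {suc n} g zero    = refl
extend-toℕ {suc n} g (suc i) = extend-toℕ (λ j → g (suc j)) i

extend-beyond : ∀ {n} (g : Fin n → Col) k → n ≤ k → extend g k ≡ ∅
extend-beyond {zero}  g k       _         = refl
extend-beyond {suc n} g (suc k) (s≤s n≤k) = extend-beyond (λ i → g (suc i)) k n≤k

columnOf : ∀ {n} → VSet n → Fin n → Col
columnOf D i = (D (false , i) , D (true , i))

columnsOf : ∀ {n} → VSet n → ℕ → Col
columnsOf D zero    = ∅
columnsOf D (suc k) = extend (columnOf D) k

columnsOf-set : ∀ {n} (D : VSet n) v → D v ≡ setOf n (columnsOf D) v
columnsOf-set D (false , i) = cong proj₁ (sym (extend-toℕ (columnOf D) i))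
columnsOf-set D (true  , i) = cong proj₂ (sym (extend-toℕ (columnOf D) i))

inColumns : ∀ {n} (D : VSet n) {a i} → T (D (a , i)) → T (inRow a (columnsOf D (suc (toℕ i))))
inColumns D {a} {i} = subst T (columnsOf-set D (a , i))

rowCovered-intro : ∀ a p c d → T (nonempty c) ⊎ (T (inRow a p) ⊎ T (inRow a d)) →
                   T (rowCovered a p c d)
rowCovered-intro a p c d = from T-∨ ∘ Sum.map₂ (from T-∨)

domination-witness : ∀ {n} (D : VSet n) → IsDominating D → ∀ a (i : Fin n) →
  let h = columnsOf D in
  T (nonempty (h (suc (toℕ i)))) ⊎ (T (inRow a (h (toℕ i))) ⊎ T (inRow a (h (suc (suc (toℕ i))))))
domination-witness D dom a i with T? (D (a , i))
... | yes a∈D = inj₁ (inRow⇒nonempty a _ (inColumns D a∈D))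
... | no a∉D with dom (a , i) a∉D
...   | (b , j) , b∈D , adj with neighbour-cases a b j i adj
...     | inj₁ (refl , refl)         = inj₁ (inRow⇒nonempty b _ (inColumns D b∈D))
...     | inj₂ (refl , inj₁ j+1≡i) =
          inj₂ (inj₁ (subst (λ k → T (inRow a (columnsOf D k))) j+1≡i (inColumns D b∈D)))
...     | inj₂ (refl , inj₂ i+1≡j) =
          inj₂ (inj₂ (subst (λ k → T (inRow a (columnsOf D (suc k)))) (sym i+1≡j) (inColumns D b∈D)))

dominating⇒covering : ∀ {n} (D : VSet n) → IsDominating D → LocallyCovering n (columnsOf D)
dominating⇒covering D dom k k<n =
  subst (λ k → T (covered (h k) (h (suc k)) (h (suc (suc k))))) (toℕ-fromℕ< k<n)
        (from T-∧ (row false , row true))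
  where
  h = columnsOf D
  i = fromℕ< k<n
  row : ∀ a → T (rowCovered a (h (toℕ i)) (h (suc (toℕ i))) (h (suc (suc (toℕ i)))))
  row a = rowCovered-intro a (h (toℕ i)) (h (suc (toℕ i))) (h (suc (suc (toℕ i))))
                           (domination-witness D dom a i)

DominatedBy : ∀ {n} → VSet n → Vertex n → Set
DominatedBy {n} S v = Σ (Vertex n) (λ u → (u ∈ₛ S) × Adj u v)

empty-row : ∀ a → ¬ T (inRow a ∅)
empty-row false ()
empty-row true  ()

-- If row a of the previous column is chosen, (a , i) has a left neighbour
-- in setOf n h; the empty virtual column 0 rules out i = 0.
left-dominator : ∀ n h a (i : Fin n) → h 0 ≡ ∅ → T (inRow a (h (toℕ i))) →
                 DominatedBy (setOf n h) (a , i)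
left-dominator n h a zero    h₀ left = ⊥-elim (empty-row a (subst (T ∘ inRow a) h₀ left))
left-dominator n h a (suc i) h₀ left =
  (a , inject₁ i) ,
  subst (λ k → T (inRow a (h (suc k)))) (sym (toℕ-inject₁ i)) left ,
  row-adjacent a (inject₁ i) (suc i) (inj₁ (cong suc (toℕ-inject₁ i)))

-- Symmetrically on the right, the empty virtual column n + 1 ruling out i = n - 1.
right-dominator : ∀ n h a (i : Fin n) → h (suc n) ≡ ∅ → T (inRow a (h (suc (suc (toℕ i))))) →
                  DominatedBy (setOf n h) (a , i)
right-dominator n h a i hₙ₊₁ right with suc (toℕ i) <? n
... | yes i+1<n =
  (a , fromℕ< i+1<n) ,
  subst (λ k → T (inRow a (h (suc k)))) (sym (toℕ-fromℕ< i+1<n)) right ,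
  row-adjacent a (fromℕ< i+1<n) i (inj₂ (sym (toℕ-fromℕ< i+1<n)))
... | no i+1≮n = ⊥-elim (empty-row a (subst (T ∘ inRow a) hₙ₊₁ lastRight))
  where
  i+1≡n : suc (toℕ i) ≡ n
  i+1≡n = ≤-antisym (toℕ<n i) (≮⇒≥ i+1≮n)
  lastRight : T (inRow a (h (suc n)))
  lastRight = subst (λ k → T (inRow a (h (suc k)))) i+1≡n right

covering⇒dominating : ∀ n h → h 0 ≡ ∅ → h (suc n) ≡ ∅ → LocallyCovering n h →
                      IsDominating (setOf n h)
covering⇒dominating n h h₀ hₙ₊₁ cov (a , i) a∉S
  with to T-∨ (covered-row a (h (toℕ i)) (h (suc (toℕ i))) (h (suc (suc (toℕ i)))) (cov (toℕ i) (toℕ<n i)))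
... | inj₁ nonempty-c = (not a , i) , nonempty⇒otherRow a _ nonempty-c a∉S , rung-adjacent a i
... | inj₂ neighbours with to T-∨ neighbours
...   | inj₁ left  = left-dominator n h a i h₀ left
...   | inj₂ right = right-dominator n h a i hₙ₊₁ right

-- An explicit dominating set: 2 |E| ≤ n + 2

zigzag : ℕ → Col
zigzag 0 = ∅
zigzag 1 = (true , false)
zigzag 2 = ∅
zigzag 3 = (false , true)
zigzag (suc (suc (suc (suc k)))) = zigzag k

swap : Col → Col
swap (x , y) = (y , x)

-- The last column: kept if nonempty, otherwise the opposite vertex of the
-- previous column, so that both of its vertices are dominated.
finish : Col → Col → Col
finish c previous = if nonempty c then c else swap previous

zigzagSeq : ℕ → ℕ → Col
zigzagSeq n zero    = ∅
zigzagSeq n (suc k) =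
  if suc k <ᵇ n then zigzag (suc k)
  else if suc k ≡ᵇ n then finish (zigzag (suc k)) (zigzag k) else ∅

<ᵇ-false : ∀ m n → n ≤ m → (m <ᵇ n) ≡ false
<ᵇ-false m n n≤m = ¬-not (λ m<ᵇn → <⇒≱ (<ᵇ⇒< m n (T-≡ .from m<ᵇn)) n≤m)

≡ᵇ-false : ∀ m n → ¬ (m ≡ n) → (m ≡ᵇ n) ≡ false
≡ᵇ-false m n m≢n = ¬-not (λ m≡ᵇn → m≢n (≡ᵇ⇒≡ m n (T-≡ .from m≡ᵇn)))

zigzagSeq-below : ∀ n k → k < n → zigzagSeq n k ≡ zigzag k
zigzagSeq-below n zero    _   = refl
zigzagSeq-below n (suc k) k<n rewrite T-≡ .to (<⇒<ᵇ k<n) = refl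

zigzagSeq-last : ∀ k → zigzagSeq (suc k) (suc k) ≡ finish (zigzag (suc k)) (zigzag k)
zigzagSeq-last k rewrite <ᵇ-false (suc k) (suc k) ≤-refl | T-≡ .to (≡⇒≡ᵇ k k refl) = refl

zigzagSeq-beyond : ∀ n k → n ≤ k → zigzagSeq n (suc k) ≡ ∅
zigzagSeq-beyond n k n≤k
  rewrite <ᵇ-false (suc k) n (≤-trans n≤k (n≤1+n k)) | ≡ᵇ-false (suc k) n (>⇒≢ (s≤s n≤k)) = refl

zigzag-covered : ∀ k → T (covered (zigzag k) (zigzag (suc k)) (zigzag (suc (suc k))))
zigzag-covered 0 = tt
zigzag-covered 1 = tt
zigzag-covered 2 = tt
zigzag-covered 3 = tt
zigzag-covered (suc (suc (suc (suc k)))) = zigzag-covered k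

zigzag-covered-beforeLast : ∀ k →
  T (covered (zigzag k) (zigzag (suc k)) (finish (zigzag (suc (suc k))) (zigzag (suc k))))
zigzag-covered-beforeLast 0 = tt
zigzag-covered-beforeLast 1 = tt
zigzag-covered-beforeLast 2 = tt
zigzag-covered-beforeLast 3 = tt
zigzag-covered-beforeLast (suc (suc (suc (suc k)))) = zigzag-covered-beforeLast k

zigzag-covered-last : ∀ k → T (covered (zigzag k) (finish (zigzag (suc k)) (zigzag k)) ∅)
zigzag-covered-last 0 = tt
zigzag-covered-last 1 = tt
zigzag-covered-last 2 = tt
zigzag-covered-last 3 = tt
zigzag-covered-last (suc (suc (suc (suc k)))) = zigzag-covered-last k

zigzagSeq-covering : ∀ n → LocallyCovering n (zigzagSeq n)
zigzagSeq-covering n k k<n with m≤n⇒m<n∨m≡n k<n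
... | inj₂ refl
  rewrite zigzagSeq-below (suc k) k k<n | zigzagSeq-last k | zigzagSeq-beyond (suc k) (suc k) ≤-refl
  = zigzag-covered-last k
... | inj₁ k+1<n with m≤n⇒m<n∨m≡n k+1<n
...   | inj₂ refl
  rewrite zigzagSeq-below (suc (suc k)) k k<n | zigzagSeq-below (suc (suc k)) (suc k) k+1<n
        | zigzagSeq-last (suc k)
  = zigzag-covered-beforeLast k
...   | inj₁ k+2<n
  rewrite zigzagSeq-below n k k<n | zigzagSeq-below n (suc k) k+1<n | zigzagSeq-below n (suc (suc k)) k+2<n
  = zigzag-covered k

zigzag-sparse : ∀ k → weight (zigzag (suc k)) + weight (zigzag (suc (suc k))) ≤ 1
zigzag-sparse 0 = ≤-refl
zigzag-sparse 1 = ≤-refl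
zigzag-sparse 2 = ≤-refl
zigzag-sparse 3 = ≤-refl
zigzag-sparse (suc (suc (suc (suc k)))) = zigzag-sparse k

finish-weight : ∀ k → weight (finish (zigzag (suc k)) (zigzag k)) ≤ 1
finish-weight 0 = ≤-refl
finish-weight 1 = ≤-refl
finish-weight 2 = ≤-refl
finish-weight 3 = ≤-refl
finish-weight (suc (suc (suc (suc k)))) = finish-weight k

zigzagSet : ∀ n → VSet n
zigzagSet n = setOf n (zigzagSeq n)

zigzagSet-dominating : ∀ n → IsDominating (zigzagSet n)
zigzagSet-dominating n =
  covering⇒dominating n (zigzagSeq n) refl (zigzagSeq-beyond n n ≤-refl) (zigzagSeq-covering n)

zigzagSet-card : ∀ m → 2 * card (zigzagSet (suc m)) ≤ suc m + 2
zigzagSet-card m = begin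
  2 * card (zigzagSet n)                  ≡⟨ cong (2 *_) (card-columns n h (zigzagSet n) (λ _ → refl)) ⟩
  2 * weightOf h n                        ≡⟨ cong (2 *_) (weightOf-snoc m h) ⟩
  2 * (weightOf h m + weight (h n))       ≡⟨ cong (λ w → 2 * (w + weight (h n))) body ⟩
  2 * (weightOf zigzag m + weight (h n))  ≡⟨ *-distribˡ-+ 2 (weightOf zigzag m) (weight (h n)) ⟩
  2 * weightOf zigzag m + 2 * weight (h n)
    ≤⟨ +-mono-≤ (weightOf-sparse m zigzag zigzag-sparse) (*-monoʳ-≤ 2 last) ⟩
  suc m + 2                               ∎
  where
  open ≤-Reasoning
  n = suc m
  h = zigzagSeq n
  body : weightOf h m ≡ weightOf zigzag m
  body = weightOf-cong m h zigzag (λ k k<m → zigzagSeq-below n (suc k) (s<s k<m))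
  last : weight (h n) ≤ 1
  last = subst (λ c → weight c ≤ 1) (sym (zigzagSeq-last m)) (finish-weight m)

-- A potential for corner-free sequences: 2 |D| + 1 ≥ n + bound

-- Number r of remaining columns, where from r = 7 on only parity matters.
data Stage : Set where
  r1 r2 r3 r4 r5 r6 rOdd rEven : Stage

next : Stage → Stage
next r1    = r2
next r2    = r3
next r3    = r4
next r4    = r5
next r5    = r6
next r6    = rOdd
next rOdd  = rEven
next rEven = rOdd

stage : ℕ → Stage
stage 0 = r1
stage 1 = r1
stage 2 = r2
stage 3 = r3
stage 4 = r4
stage 5 = r5
stage 6 = r6
stage 7 = rOdd
stage 8 = rEven
stage (suc (suc r@(suc (suc (suc (suc (suc (suc (suc _))))))))) = stage r

stage-suc : ∀ r → stage (suc (suc r)) ≡ next (stage (suc r))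
stage-suc 0 = refl
stage-suc 1 = refl
stage-suc 2 = refl
stage-suc 3 = refl
stage-suc 4 = refl
stage-suc 5 = refl
stage-suc 6 = refl
stage-suc 7 = refl
stage-suc (suc (suc r@(suc (suc (suc (suc (suc (suc _)))))))) = stage-suc r

byStage : ℕ → ℕ → ℕ → ℕ → ℕ → ℕ → ℕ → ℕ → Stage → ℕ
byStage v₁ v₂ v₃ v₄ v₅ v₆ vₒ vₑ r1    = v₁
byStage v₁ v₂ v₃ v₄ v₅ v₆ vₒ vₑ r2    = v₂
byStage v₁ v₂ v₃ v₄ v₅ v₆ vₒ vₑ r3    = v₃
byStage v₁ v₂ v₃ v₄ v₅ v₆ vₒ vₑ r4    = v₄
byStage v₁ v₂ v₃ v₄ v₅ v₆ vₒ vₑ r5    = v₅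
byStage v₁ v₂ v₃ v₄ v₅ v₆ vₒ vₑ r6    = v₆
byStage v₁ v₂ v₃ v₄ v₅ v₆ vₒ vₑ rOdd  = vₒ
byStage v₁ v₂ v₃ v₄ v₅ v₆ vₒ vₑ rEven = vₑ

-- bound p c r is the least value of 2 W − r + 1, where W is the weight of
-- r remaining columns c = c₁, …, c_r preceded by p, each covered, with
-- c_r = ∅ and followed by ∅.  It was computed by dynamic programming;
-- states admitting no such completion get the large values 31 and 30.
bound : Col → Col → Stage → ℕ
bound (false , false) (false , false) = byStage 31 30 2 5 4 3 4 5
bound (true  , true ) (false , false) = byStage  0 30 2 1 2 3 2 3
bound _               (false , false) = byStage 31 30 2 3 2 3 2 3
bound _               (true  , true ) = byStage 31  3 6 5 4 5 6 5
bound _               _               = byStage 31 31 4 3 4 3 4 3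

ForAllColumns : (Col → Set) → Set
ForAllColumns P = P (false , false) × P (true , false) × P (false , true) × P (true , true)

forAllColumns : ∀ (P : Col → Set) → ForAllColumns P → ∀ c → P c
forAllColumns P (p , _)         (false , false) = p
forAllColumns P (_ , p , _)     (true  , false) = p
forAllColumns P (_ , _ , p , _) (false , true ) = p
forAllColumns P (_ , _ , _ , p) (true  , true ) = p

ForAllStages : (Stage → Set) → Set
ForAllStages P = P r1 × P r2 × P r3 × P r4 × P r5 × P r6 × P rOdd × P rEven

forAllStages : ∀ (P : Stage → Set) → ForAllStages P → ∀ r → P r
forAllStages P (p , _)                         r1    = p
forAllStages P (_ , p , _)                     r2    = p
forAllStages P (_ , _ , p , _)                 r3    = p
forAllStages P (_ , _ , _ , p , _)             r4    = p
forAllStages P (_ , _ , _ , _ , p , _)         r5    = p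
forAllStages P (_ , _ , _ , _ , _ , p , _)     r6    = p
forAllStages P (_ , _ , _ , _ , _ , _ , p , _) rOdd  = p
forAllStages P (_ , _ , _ , _ , _ , _ , _ , p) rEven = p

-- The Bellman inequality of the potential: prepending a covered column c
-- (between p and d) to a stage-r state costs 2·weight c − 1.
bellmanᵇ : Stage → Col → Col → Col → Bool
bellmanᵇ r p c d = not (covered p c d) ∨ (suc (bound p c (next r)) ≤ᵇ 2 * weight c + bound c d r)

BellmanTable : Stage → Set
BellmanTable r = ForAllColumns λ p → ForAllColumns λ c → ForAllColumns λ d → T (bellmanᵇ r p c d)

-- All 8 · 4³ instances hold by evaluation: each is the unit type, so the
-- whole table is inhabited by its unique element.
bellman-table : ForAllStages BellmanTable
bellman-table = _

bellman-checked : ∀ r p c d → T (bellmanᵇ r p c d)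
bellman-checked r p c d =
  forAllColumns (λ d → T (bellmanᵇ r p c d))
    (forAllColumns (λ c → ForAllColumns λ d → T (bellmanᵇ r p c d))
      (forAllColumns (λ p → ForAllColumns λ c → ForAllColumns λ d → T (bellmanᵇ r p c d))
        (forAllStages BellmanTable bellman-table r) p) c) d

bellman : ∀ r p c d → T (covered p c d) → suc (bound p c (next r)) ≤ 2 * weight c + bound c d r
bellman r p c d cov with to T-∨ (bellman-checked r p c d)
... | inj₁ uncovered = ⊥-elim (subst T (T-not-≡ .to uncovered) cov)
... | inj₂ holds     = ≤ᵇ⇒≤ _ _ holds

-- The only covered state before a final empty column is p = {x , y}, with
-- potential 0.
bound-final : ∀ p → T (covered p ∅ ∅) → bound p ∅ r1 ≡ 0
bound-final (true , true) _ = refl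

double-step : ∀ a b → 2 * a + (2 * b + 1) ≡ 2 * (a + b) + 1
double-step = solve-∀

potential-bound : ∀ m h → LocallyCovering (suc m) h → h (suc m) ≡ ∅ → h (suc (suc m)) ≡ ∅ →
                  bound (h 0) (h 1) (stage (suc m)) + suc m ≤ 2 * weightOf h (suc m) + 1
potential-bound zero h cov h₁ h₂ = begin
  bound (h 0) (h 1) r1 + 1  ≡⟨ cong (λ c → bound (h 0) c r1 + 1) h₁ ⟩
  bound (h 0) ∅ r1 + 1      ≡⟨ cong (_+ 1) (bound-final (h 0) final) ⟩
  1                         ≤⟨ m≤n+m 1 _ ⟩
  2 * weightOf h 1 + 1      ∎
  where
  open ≤-Reasoning
  final : T (covered (h 0) ∅ ∅)
  final = subst₂ (λ c d → T (covered (h 0) c d)) h₁ h₂ (cov 0 z<s)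
potential-bound (suc m) h cov hₗ hₗ₊₁ = begin
  bound (h 0) (h 1) (stage (2 + m)) + (2 + m)
    ≡⟨ cong (λ r → bound (h 0) (h 1) r + (2 + m)) (stage-suc m) ⟩
  bound (h 0) (h 1) (next r) + (2 + m)
    ≡⟨ +-suc _ (suc m) ⟩
  suc (bound (h 0) (h 1) (next r)) + suc m
    ≤⟨ +-monoˡ-≤ (suc m) (bellman r (h 0) (h 1) (h 2) (cov 0 z<s)) ⟩
  (2 * weight (h 1) + bound (h 1) (h 2) r) + suc m
    ≡⟨ +-assoc (2 * weight (h 1)) _ (suc m) ⟩
  2 * weight (h 1) + (bound (h 1) (h 2) r + suc m)
    ≤⟨ +-monoʳ-≤ (2 * weight (h 1)) rest ⟩
  2 * weight (h 1) + (2 * weightOf (shift h) (suc m) + 1)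
    ≡⟨ double-step (weight (h 1)) _ ⟩
  2 * weightOf h (2 + m) + 1 ∎
  where
  open ≤-Reasoning
  r = stage (suc m)
  rest : bound (h 1) (h 2) r + suc m ≤ 2 * weightOf (shift h) (suc m) + 1
  rest = potential-bound m (shift h) (λ k k<m+1 → cov (suc k) (s<s k<m+1)) hₗ hₗ₊₁

small-bound : ∀ n → bound ∅ ∅ (stage n) ≤ 3 → n ≡ 3 ⊎ n ≡ 6
small-bound 0 (s≤s (s≤s (s≤s ())))
small-bound 1 (s≤s (s≤s (s≤s ())))
small-bound 2 (s≤s (s≤s (s≤s ())))
small-bound 3 _ = inj₁ refl
small-bound 4 (s≤s (s≤s (s≤s ())))
small-bound 5 (s≤s (s≤s (s≤s ())))
small-bound 6 _ = inj₂ refl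
small-bound (suc (suc (suc (suc (suc (suc (suc k))))))) ≤3 = ⊥-elim (large k ≤3)
  where
  large : ∀ k → ¬ (bound ∅ ∅ (stage (7 + k)) ≤ 3)
  large 0 (s≤s (s≤s (s≤s ())))
  large 1 (s≤s (s≤s (s≤s ())))
  large (suc (suc k)) = large k

cornerFree-bound : ∀ m (D : VSet (suc m)) → IsDominating D →
  (∀ a → D (a , zero) ≡ false) → (∀ a → D (a , fromℕ m) ≡ false) →
  bound ∅ ∅ (stage (suc m)) + suc m ≤ 2 * card D + 1
cornerFree-bound m D dom first last =
  subst₂ (λ c w → bound ∅ c (stage (suc m)) + suc m ≤ 2 * w + 1) h₁ (sym size)
    (potential-bound m h (dominating⇒covering D dom) hₗ hₗ₊₁)
  where
  h = columnsOf D
  h₁ : h 1 ≡ ∅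
  h₁ = cong₂ _,_ (first false) (first true)
  hₗ : h (suc m) ≡ ∅
  hₗ = begin
    extend (columnOf D) m             ≡⟨ cong (extend (columnOf D)) (sym (toℕ-fromℕ m)) ⟩
    extend (columnOf D) (toℕ (fromℕ m)) ≡⟨ extend-toℕ (columnOf D) (fromℕ m) ⟩
    columnOf D (fromℕ m)              ≡⟨ cong₂ _,_ (last false) (last true) ⟩
    ∅                                 ∎
    where open ≡-Reasoning
  hₗ₊₁ : h (suc (suc m)) ≡ ∅
  hₗ₊₁ = extend-beyond (columnOf D) (suc m) ≤-refl
  size : card D ≡ weightOf h (suc m)
  size = card-columns (suc m) h D (columnsOf-set D)

lemma3p3 : (n : ℕ) → 3 ≤ n →
    Σ (VSet n) (λ D → IsMinimumDominating D × (∀ v → v ∈ₛ D → ¬ (degree v ≡ 2))) →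
    (n ≡ 3) ⊎ (n ≡ 6)
lemma3p3 1 (s≤s ()) _
lemma3p3 2 (s≤s (s≤s ())) _
lemma3p3 (suc (suc (suc m))) _ (D , (dominating , minimum) , avoidsCorners) =
  small-bound n (+-cancelʳ-≤ n _ 3 squeeze)
  where
  n = 3 + m
  outside : ∀ v → degree v ≡ 2 → D v ≡ false
  outside v degree≡2 = ¬-not (λ v∈D → avoidsCorners v (T-≡ .from v∈D) degree≡2)
  squeeze : bound ∅ ∅ (stage n) + n ≤ 3 + n
  squeeze = begin
    bound ∅ ∅ (stage n) + n
      ≤⟨ cornerFree-bound (2 + m) D dominating (λ a → outside _ (corner-first (suc m) a))
                                              (λ a → outside _ (corner-last (suc m) a)) ⟩
    2 * card D + 1
      ≤⟨ +-monoˡ-≤ 1 (*-monoʳ-≤ 2 (minimum (zigzagSet n) (zigzagSet-dominating n))) ⟩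
    2 * card (zigzagSet n) + 1
      ≤⟨ +-monoˡ-≤ 1 (zigzagSet-card (2 + m)) ⟩
    n + 2 + 1
      ≡⟨ trans (+-assoc n 2 1) (+-comm n 3) ⟩
    3 + n ∎
    where open ≤-Reasoning
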